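{- Let \(G\) be a finite simple connected graph with \(\Delta(G)\leq 4\), not isomorphic to \(O_3\). Let \(\{q_{1},q_{2},q_{3}\}\) be a triangle in \(K(G)\) that is contained in \(x^{*}\cap y^{*}\) for vertices \(x,y\in G\). Then \(x^{*}=y^{*}\).
   Context: A clique is a maximal complete subgraph; \(K(G)\) is the intersection graph of the cliques of \(G\). For \(x\in G\), the star \(x^{*}=\{q\in K(G)\mid x\in q\}\) (a complete subgraph of \(K(G)\)). \(O_3\) is the complement of the disjoint union of three edges. -}

module Defs where

open import Data.Nat using (ℕ; _≤_)
open import Data.Bool using (Bool; true; false; not; _∧_)
open import Data.Fin using (Fin; zero; suc; _≟_)
open import Data.Fin.Subset using (Subset; _∈_; _⊆_; _∩_; Nonempty; ∣_∣)
open import Data.Vec using (tabulate)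
open import Data.Product using (Σ; _×_; _,_)
open import Relation.Nullary using (¬_)
open import Relation.Nullary.Decidable using (⌊_⌋)
open import Relation.Binary.PropositionalEquality using (_≡_; _≢_)
open import Function.Bundles using (_↔_; Inverse)

record Graph (n : ℕ) : Set where
  field
    adj   : Fin n → Fin n → Bool
    sym   : ∀ u v → adj u v ≡ adj v u
    irrefl : ∀ u → adj u u ≡ false
open Graph public

module _ {n : ℕ} (G : Graph n) where

  data Walk : Fin n → Fin n → Set where
    stay : ∀ u → Walk u u
    step : ∀ {u v w} → adj G u v ≡ true → Walk v w → Walk u w

  Connected : Set
  Connected = ∀ u v → Walk u v

  nbhd : Fin n → Subset n
  nbhd u = tabulate (λ v → adj G u v)

  degree : Fin n → ℕ
  degree u = ∣ nbhd u ∣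

  MaxDegree≤ : ℕ → Set
  MaxDegree≤ k = ∀ u → degree u ≤ k

  Complete : Subset n → Set
  Complete S = ∀ u v → u ∈ S → v ∈ S → u ≢ v → adj G u v ≡ true

  IsClique : Subset n → Set
  IsClique S = Complete S × (∀ T → Complete T → S ⊆ T → T ⊆ S)

  -- adjacency in the clique graph K(G): distinct cliques that intersect
  KAdj : Subset n → Subset n → Set
  KAdj q r = q ≢ r × Nonempty (q ∩ r)

  InStar : Fin n → Subset n → Set
  InStar x q = IsClique q × x ∈ q

  SameStar : Fin n → Fin n → Set
  SameStar x y = ∀ q → IsClique q → (x ∈ q → y ∈ q) × (y ∈ q → x ∈ q)

_≅_ : ∀ {n m} → Graph n → Graph m → Set
_≅_ {n} {m} G H =
  Σ (Fin n ↔ Fin m) λ f → ∀ u v → adj G u v ≡ adj H (Inverse.to f u) (Inverse.to f v)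

-- O₃: complement of three disjoint edges {0,1},{2,3},{4,5} on 6 vertices
partner : Fin 6 → Fin 6
partner zero = suc zero
partner (suc zero) = zero
partner (suc (suc zero)) = suc (suc (suc zero))
partner (suc (suc (suc zero))) = suc (suc zero)
partner (suc (suc (suc (suc zero)))) = suc (suc (suc (suc (suc zero))))
partner (suc (suc (suc (suc (suc zero))))) = suc (suc (suc (suc zero)))

O₃adj : Fin 6 → Fin 6 → Bool
O₃adj u v = not ⌊ u ≟ v ⌋ ∧ not ⌊ partner u ≟ v ⌋

O₃ : Graph 6
O₃ = record { adj = O₃adj ; sym = symO ; irrefl = irr }
  where
  symO : ∀ u v → O₃adj u v ≡ O₃adj v u
  symO (zero) (zero) = _≡_.refl
  symO (zero) (suc (zero)) = _≡_.refl
  symO (zero) (suc (suc (zero))) = _≡_.refl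
  symO (zero) (suc (suc (suc (zero)))) = _≡_.refl
  symO (zero) (suc (suc (suc (suc (zero))))) = _≡_.refl
  symO (zero) (suc (suc (suc (suc (suc (zero)))))) = _≡_.refl
  symO (suc (zero)) (zero) = _≡_.refl
  symO (suc (zero)) (suc (zero)) = _≡_.refl
  symO (suc (zero)) (suc (suc (zero))) = _≡_.refl
  symO (suc (zero)) (suc (suc (suc (zero)))) = _≡_.refl
  symO (suc (zero)) (suc (suc (suc (suc (zero))))) = _≡_.refl
  symO (suc (zero)) (suc (suc (suc (suc (suc (zero)))))) = _≡_.refl
  symO (suc (suc (zero))) (zero) = _≡_.refl
  symO (suc (suc (zero))) (suc (zero)) = _≡_.refl
  symO (suc (suc (zero))) (suc (suc (zero))) = _≡_.refl
  symO (suc (suc (zero))) (suc (suc (suc (zero)))) = _≡_.refl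
  symO (suc (suc (zero))) (suc (suc (suc (suc (zero))))) = _≡_.refl
  symO (suc (suc (zero))) (suc (suc (suc (suc (suc (zero)))))) = _≡_.refl
  symO (suc (suc (suc (zero)))) (zero) = _≡_.refl
  symO (suc (suc (suc (zero)))) (suc (zero)) = _≡_.refl
  symO (suc (suc (suc (zero)))) (suc (suc (zero))) = _≡_.refl
  symO (suc (suc (suc (zero)))) (suc (suc (suc (zero)))) = _≡_.refl
  symO (suc (suc (suc (zero)))) (suc (suc (suc (suc (zero))))) = _≡_.refl
  symO (suc (suc (suc (zero)))) (suc (suc (suc (suc (suc (zero)))))) = _≡_.refl
  symO (suc (suc (suc (suc (zero))))) (zero) = _≡_.refl
  symO (suc (suc (suc (suc (zero))))) (suc (zero)) = _≡_.refl
  symO (suc (suc (suc (suc (zero))))) (suc (suc (zero))) = _≡_.refl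
  symO (suc (suc (suc (suc (zero))))) (suc (suc (suc (zero)))) = _≡_.refl
  symO (suc (suc (suc (suc (zero))))) (suc (suc (suc (suc (zero))))) = _≡_.refl
  symO (suc (suc (suc (suc (zero))))) (suc (suc (suc (suc (suc (zero)))))) = _≡_.refl
  symO (suc (suc (suc (suc (suc (zero)))))) (zero) = _≡_.refl
  symO (suc (suc (suc (suc (suc (zero)))))) (suc (zero)) = _≡_.refl
  symO (suc (suc (suc (suc (suc (zero)))))) (suc (suc (zero))) = _≡_.refl
  symO (suc (suc (suc (suc (suc (zero)))))) (suc (suc (suc (zero)))) = _≡_.refl
  symO (suc (suc (suc (suc (suc (zero)))))) (suc (suc (suc (suc (zero))))) = _≡_.refl
  symO (suc (suc (suc (suc (suc (zero)))))) (suc (suc (suc (suc (suc (zero)))))) = _≡_.refl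
  irr : ∀ u → O₃adj u u ≡ false
  irr zero = _≡_.refl
  irr (suc zero) = _≡_.refl
  irr (suc (suc zero)) = _≡_.refl
  irr (suc (suc (suc zero))) = _≡_.refl
  irr (suc (suc (suc (suc zero)))) = _≡_.refl
  irr (suc (suc (suc (suc (suc zero))))) = _≡_.refl

-- If a clique q contained x but not y, x would have five distinct neighbours:
-- y, three common neighbours of x and y extracted from the pairwise differences
-- of q₁, q₂, q₃, and a vertex of q that maximality of q forces to be
-- non-adjacent to y. This contradicts Δ(G) ≤ 4.
module Submission where

open import Defs
open import Data.Nat using (ℕ; _≤_; _+_; z≤n; s≤s)
open import Data.Nat.Properties using (≤-refl; ≤-trans; <-irrefl)
open import Data.Fin using (Fin; _≟_)
open import Data.Fin.Subset using (Subset; _∈_; _∉_; _∪_; ⁅_⁆; _-_; ∣_∣)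
open import Data.Fin.Subset.Properties
  using (_∈?_; ⊆-antisym; x∈p∧x≢y⇒x∈p-y; x∈p⇒∣p-x∣<∣p∣; p⊆p∪q; q⊆p∪q; x∈p∪q⁻; x∈⁅x⁆; x∈⁅y⁆⇒x≡y)
open import Data.Fin.Properties using (¬∀⟶∃¬)
open import Data.Vec.Properties using (lookup∘tabulate; lookup⇒[]=)
open import Data.Bool using (true; false)
open import Data.Bool.Properties using (¬-not; not-¬) renaming (_≟_ to _≟ᵇ_)
open import Data.List using (List; []; _∷_; length)
open import Data.List.Relation.Unary.All using (All; []; _∷_)
import Data.List.Relation.Unary.All as All
open import Data.List.Relation.Unary.AllPairs using ([]; _∷_)
open import Data.List.Relation.Unary.Unique.Propositional using (Unique)
open import Data.Product using (∃; _×_; _,_)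
open import Data.Sum using (_⊎_; inj₁; inj₂)
open import Relation.Nullary using (¬_; Dec; yes; no; contradiction)
open import Relation.Nullary.Decidable using (_→-dec_; ¬?; decidable-stable)
open import Relation.Binary.PropositionalEquality using (_≡_; _≢_; refl; trans; ≢-sym)

unique-⊆⇒length≤∣∣ : ∀ {n} {p : Subset n} {xs : List (Fin n)} →
                      Unique xs → All (_∈ p) xs → length xs ≤ ∣ p ∣
unique-⊆⇒length≤∣∣ [] [] = z≤n
unique-⊆⇒length≤∣∣ {p = p} {x ∷ xs} (x∉xs ∷ unique) (x∈p ∷ xs⊆p) =
  ≤-trans (s≤s (unique-⊆⇒length≤∣∣ unique xs⊆p-x)) (x∈p⇒∣p-x∣<∣p∣ x∈p)
  where
  xs⊆p-x : All (_∈ p - x) xs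
  xs⊆p-x = All.zipWith (λ (w∈p , x≢w) → x∈p∧x≢y⇒x∈p-y w∈p (≢-sym x≢w)) (xs⊆p , x∉xs)

∈∧∉⇒≢ : ∀ {n} {q : Subset n} {u v} → u ∈ q → v ∉ q → u ≢ v
∈∧∉⇒≢ u∈q v∉q refl = v∉q u∈q

module _ {n : ℕ} (G : Graph n) where

  Adj : Fin n → Fin n → Set
  Adj u v = adj G u v ≡ true

  adj∧nonadj⇒≢ : ∀ {u v w} → Adj u v → adj G u w ≡ false → v ≢ w
  adj∧nonadj⇒≢ uv ¬uw refl = not-¬ ¬uw uv

  CommonNeighbour : Fin n → Fin n → Fin n → Set
  CommonNeighbour x y v = Adj x v × Adj y v × x ≢ v × y ≢ v

  adj⇒∈nbhd : ∀ {u v} → Adj u v → v ∈ nbhd G u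
  adj⇒∈nbhd {u} {v} uv = lookup⇒[]= v (nbhd G u) (trans (lookup∘tabulate (adj G u) v) uv)

  unique-neighbours⇒length≤degree : ∀ {u vs} → Unique vs → All (Adj u) vs → length vs ≤ degree G u
  unique-neighbours⇒length≤degree unique adjs = unique-⊆⇒length≤∣∣ unique (All.map adj⇒∈nbhd adjs)

  clique⊈complete : ∀ {q r} → IsClique G q → Complete G r → q ≢ r → ∃ λ c → c ∈ q × c ∉ r
  clique⊈complete {q} {r} (_ , maximal) r-complete q≢r
    with ¬∀⟶∃¬ n (λ c → c ∈ q → c ∈ r) (λ c → (c ∈? q) →-dec (c ∈? r))
           (λ q⊆r → q≢r (⊆-antisym (q⊆r _) (maximal r r-complete (q⊆r _))))
  ... | c , c∉q⇒r with c ∈? q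
  ... | yes c∈q = c , c∈q , λ c∈r → c∉q⇒r (λ _ → c∈r)
  ... | no c∉q = contradiction (λ c∈q → contradiction c∈q c∉q) c∉q⇒r

  complete-∪⁅⁆ : ∀ {q y} → Complete G q → (∀ z → z ∈ q → z ≢ y → Adj y z) → Complete G (q ∪ ⁅ y ⁆)
  complete-∪⁅⁆ {q} {y} q-complete y-adj u v u∈ v∈ u≢v = go (x∈p∪q⁻ q ⁅ y ⁆ u∈) (x∈p∪q⁻ q ⁅ y ⁆ v∈)
    where
    go : u ∈ q ⊎ u ∈ ⁅ y ⁆ → v ∈ q ⊎ v ∈ ⁅ y ⁆ → Adj u v
    go (inj₁ u∈q) (inj₁ v∈q) = q-complete u v u∈q v∈q u≢v
    go (inj₁ u∈q) (inj₂ v∈y) with refl ← x∈⁅y⁆⇒x≡y y v∈y =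
      trans (Graph.sym G u y) (y-adj u u∈q u≢v)
    go (inj₂ u∈y) (inj₁ v∈q) with refl ← x∈⁅y⁆⇒x≡y y u∈y = y-adj v v∈q (≢-sym u≢v)
    go (inj₂ u∈y) (inj₂ v∈y) with refl ← x∈⁅y⁆⇒x≡y y u∈y | refl ← x∈⁅y⁆⇒x≡y y v∈y =
      contradiction refl u≢v

  ∉clique⇒∃non-neighbour : ∀ {q y} → IsClique G q → y ∉ q →
                           ∃ λ z → z ∈ q × z ≢ y × adj G y z ≡ false
  ∉clique⇒∃non-neighbour {q} {y} (q-complete , maximal) y∉q
    with ¬∀⟶∃¬ n (λ z → z ∈ q → z ≢ y → Adj y z)
           (λ z → (z ∈? q) →-dec (¬? (z ≟ y) →-dec (adj G y z ≟ᵇ true)))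
           (λ y-adj → y∉q (maximal (q ∪ ⁅ y ⁆) (complete-∪⁅⁆ q-complete y-adj)
                                    (p⊆p∪q ⁅ y ⁆) (q⊆p∪q q ⁅ y ⁆ (x∈⁅x⁆ y))))
  ... | z , ¬z-adj with z ∈? q | z ≟ y
  ... | no z∉q  | _      = contradiction (λ z∈q → contradiction z∈q z∉q) ¬z-adj
  ... | yes _   | yes z≡y = contradiction (λ _ z≢y → contradiction z≡y z≢y) ¬z-adj
  ... | yes z∈q | no z≢y = z , z∈q , z≢y , ¬-not (λ yz → ¬z-adj (λ _ _ → yz))

  ∈∖⇒common-neighbour : ∀ {q r x y v} → Complete G q → x ∈ q → y ∈ q → x ∈ r → y ∈ r →
                        v ∈ q → v ∉ r → CommonNeighbour x y v
  ∈∖⇒common-neighbour q-complete x∈q y∈q x∈r y∈r v∈q v∉r =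
    q-complete _ _ x∈q v∈q x≢v , q-complete _ _ y∈q v∈q y≢v , x≢v , y≢v
    where
    x≢v = ∈∧∉⇒≢ x∈r v∉r
    y≢v = ∈∧∉⇒≢ y∈r v∉r

  -- Two distinct cliques through x and y each own a common neighbour the other
  -- lacks; a third clique differs from one of them at a vertex distinct from both.
  three-cliques⇒three-common-neighbours :
    ∀ {q₁ q₂ q₃ x y} → IsClique G q₁ → IsClique G q₂ → IsClique G q₃ →
    q₁ ≢ q₂ → q₁ ≢ q₃ → q₂ ≢ q₃ →
    x ∈ q₁ → x ∈ q₂ → x ∈ q₃ → y ∈ q₁ → y ∈ q₂ → y ∈ q₃ →
    ∃ λ vs → 3 ≤ length vs × Unique vs × All (CommonNeighbour x y) vs
  three-cliques⇒three-common-neighbours {q₁} {q₂} {q₃} {x} {y} c₁@(k₁ , _) c₂@(k₂ , _) c₃@(k₃ , _)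
    q₁≢q₂ q₁≢q₃ q₂≢q₃ x₁ x₂ x₃ y₁ y₂ y₃
    with a , a∈q₁ , a∉q₂ ← clique⊈complete c₁ k₂ q₁≢q₂
       | b , b∈q₂ , b∉q₁ ← clique⊈complete c₂ k₁ (≢-sym q₁≢q₂)
    = third (a ∈? q₃) (b ∈? q₃)
    where
    triple : ∀ {c} → CommonNeighbour x y c → c ≢ a → c ≢ b →
             ∃ λ vs → 3 ≤ length vs × Unique vs × All (CommonNeighbour x y) vs
    triple {c} c-common c≢a c≢b =
      a ∷ b ∷ c ∷ [] , ≤-refl
      , (∈∧∉⇒≢ a∈q₁ b∉q₁ ∷ ≢-sym c≢a ∷ []) ∷ (≢-sym c≢b ∷ []) ∷ [] ∷ []
      , ∈∖⇒common-neighbour k₁ x₁ y₁ x₂ y₂ a∈q₁ a∉q₂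
      ∷ ∈∖⇒common-neighbour k₂ x₂ y₂ x₁ y₁ b∈q₂ b∉q₁ ∷ c-common ∷ []

    third : Dec (a ∈ q₃) → Dec (b ∈ q₃) →
            ∃ λ vs → 3 ≤ length vs × Unique vs × All (CommonNeighbour x y) vs
    third (yes a∈q₃) (yes b∈q₃) with c , c∈q₁ , c∉q₃ ← clique⊈complete c₁ k₃ q₁≢q₃ =
      triple (∈∖⇒common-neighbour k₁ x₁ y₁ x₃ y₃ c∈q₁ c∉q₃)
             (≢-sym (∈∧∉⇒≢ a∈q₃ c∉q₃)) (∈∧∉⇒≢ c∈q₁ b∉q₁)
    third (yes a∈q₃) (no b∉q₃) with c , c∈q₃ , c∉q₁ ← clique⊈complete c₃ k₁ (≢-sym q₁≢q₃) =
      triple (∈∖⇒common-neighbour k₃ x₃ y₃ x₁ y₁ c∈q₃ c∉q₁)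
             (≢-sym (∈∧∉⇒≢ a∈q₁ c∉q₁)) (∈∧∉⇒≢ c∈q₃ b∉q₃)
    third (no a∉q₃) _ with c , c∈q₃ , c∉q₂ ← clique⊈complete c₃ k₂ (≢-sym q₂≢q₃) =
      triple (∈∖⇒common-neighbour k₃ x₃ y₃ x₂ y₂ c∈q₃ c∉q₂)
             (∈∧∉⇒≢ c∈q₃ a∉q₃) (≢-sym (∈∧∉⇒≢ b∈q₂ c∉q₂))

  common-neighbours+2≤degree : ∀ {x y z vs} → Adj x y → Adj x z → z ≢ y → adj G y z ≡ false →
                               Unique vs → All (CommonNeighbour x y) vs → 2 + length vs ≤ degree G x
  common-neighbours+2≤degree {x} {y} {z} {vs} xy xz z≢y ¬yz unique commons =
    unique-neighbours⇒length≤degree {vs = y ∷ z ∷ vs}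
      ((≢-sym z≢y ∷ All.map (λ (_ , _ , _ , y≢v) → y≢v) commons)
       ∷ All.map (λ (_ , yv , _) → ≢-sym (adj∧nonadj⇒≢ yv ¬yz)) commons ∷ unique)
      (xy ∷ xz ∷ All.map (λ (xv , _) → xv) commons)

  clique∌y⇒5≤degree : ∀ {x y q₁ q₂ q₃ q} → x ≢ y →
    IsClique G q₁ → IsClique G q₂ → IsClique G q₃ → q₁ ≢ q₂ → q₁ ≢ q₃ → q₂ ≢ q₃ →
    x ∈ q₁ → x ∈ q₂ → x ∈ q₃ → y ∈ q₁ → y ∈ q₂ → y ∈ q₃ →
    IsClique G q → x ∈ q → y ∉ q → 5 ≤ degree G x
  clique∌y⇒5≤degree x≢y c₁@(k₁ , _) c₂ c₃ q₁≢q₂ q₁≢q₃ q₂≢q₃ x₁ x₂ x₃ y₁ y₂ y₃ c@(k , _) x∈q y∉q =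
    let z , z∈q , z≢y , ¬yz = ∉clique⇒∃non-neighbour c y∉q
        vs , 3≤∣vs∣ , unique , commons =
          three-cliques⇒three-common-neighbours c₁ c₂ c₃ q₁≢q₂ q₁≢q₃ q₂≢q₃ x₁ x₂ x₃ y₁ y₂ y₃
        x≢z = adj∧nonadj⇒≢ (k₁ _ _ y₁ x₁ (≢-sym x≢y)) ¬yz
    in ≤-trans (s≤s (s≤s 3≤∣vs∣))
               (common-neighbours+2≤degree (k₁ _ _ x₁ y₁ x≢y) (k _ _ x∈q z∈q x≢z) z≢y ¬yz unique commons)

  clique∋x⇒clique∋y : ∀ {x y q₁ q₂ q₃ q} → MaxDegree≤ G 4 → x ≢ y →
    IsClique G q₁ → IsClique G q₂ → IsClique G q₃ → q₁ ≢ q₂ → q₁ ≢ q₃ → q₂ ≢ q₃ →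
    x ∈ q₁ → x ∈ q₂ → x ∈ q₃ → y ∈ q₁ → y ∈ q₂ → y ∈ q₃ →
    IsClique G q → x ∈ q → y ∈ q
  clique∋x⇒clique∋y {x} {y} {q = q} Δ≤4 x≢y c₁ c₂ c₃ q₁≢q₂ q₁≢q₃ q₂≢q₃ x₁ x₂ x₃ y₁ y₂ y₃ c x∈q =
    decidable-stable (y ∈? q) λ y∉q →
      <-irrefl refl (≤-trans (clique∌y⇒5≤degree x≢y c₁ c₂ c₃ q₁≢q₂ q₁≢q₃ q₂≢q₃
                                                 x₁ x₂ x₃ y₁ y₂ y₃ c x∈q y∉q) (Δ≤4 x))

mainTheorem11 : ∀ {n : ℕ} (G : Graph n) → Connected G → MaxDegree≤ G 4 → ¬ (G ≅ O₃)
    → (q₁ q₂ q₃ : Subset n) → IsClique G q₁ → IsClique G q₂ → IsClique G q₃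
    → KAdj G q₁ q₂ → KAdj G q₁ q₃ → KAdj G q₂ q₃
    → (x y : Fin n)
    → InStar G x q₁ → InStar G x q₂ → InStar G x q₃
    → InStar G y q₁ → InStar G y q₂ → InStar G y q₃
    → SameStar G x y
mainTheorem11 G _ Δ≤4 _ q₁ q₂ q₃ c₁ c₂ c₃ (q₁≢q₂ , _) (q₁≢q₃ , _) (q₂≢q₃ , _) x y
  (_ , x₁) (_ , x₂) (_ , x₃) (_ , y₁) (_ , y₂) (_ , y₃) q c with x ≟ y
... | yes refl = (λ x∈q → x∈q) , (λ x∈q → x∈q)
... | no x≢y =
  clique∋x⇒clique∋y G Δ≤4 x≢y c₁ c₂ c₃ q₁≢q₂ q₁≢q₃ q₂≢q₃ x₁ x₂ x₃ y₁ y₂ y₃ c ,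
  clique∋x⇒clique∋y G Δ≤4 (≢-sym x≢y) c₁ c₂ c₃ q₁≢q₂ q₁≢q₃ q₂≢q₃ y₁ y₂ y₃ x₁ x₂ x₃ c
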